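{- If an infinite word $\mathbf{w}$ over a finite alphabet has pseudoperiod $S=(p_1,\ldots,p_k)$, then $\mathbf{w}$ contains at most $\max S=p_k$ distinct letters. If it contains exactly $p_k$ distinct letters, then $\mathbf{w}$ has a suffix of the form $x^\omega$, where $x$ is a word of length $p_k$ containing each of these letters exactly once.
   Context: Words are indexed starting at $0$. For integers $k\ge1$ and $0<p_1<\cdots<p_k$, an infinite word $a_0a_1a_2\cdots$ has pseudoperiod $(p_1,\ldots,p_k)$ if $a_i\in\{a_{i+p_1},\ldots,a_{i+p_k}\}$ for all $i\ge0$. For a nonempty finite word $x$, $x^\omega=xxx\cdots$. -}

module Defs where

open import Data.Nat using (ℕ; zero; suc; _+_; _*_; _≤_; _<_)
open import Data.Fin using (Fin; toℕ) renaming (zero to fzero)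
open import Data.Product using (Σ; ∃; _×_; _,_)
open import Relation.Binary.PropositionalEquality using (_≡_)
open import Function.Definitions using (Injective)

Word : Set → Set
Word A = ℕ → A

-- A sequence of periods (p_0, …, p_k) (k+1 ≥ 1 entries, 0-indexed here)
-- with 0 < p_0 < p_1 < ⋯ < p_k.
ValidPeriods : (k : ℕ) → (Fin (suc k) → ℕ) → Set
ValidPeriods k p = (0 < p fzero) × (∀ (i j : Fin (suc k)) → toℕ i < toℕ j → p i < p j)

HasPseudoperiod : {A : Set} → Word A → (k : ℕ) → (Fin (suc k) → ℕ) → Set
HasPseudoperiod w k p = ∀ (i : ℕ) → ∃ λ (j : Fin (suc k)) → w i ≡ w (i + p j)

AtMostLetters : {A : Set} → Word A → ℕ → Set
AtMostLetters w n = ∀ (m : ℕ) (f : Fin m → ℕ) → Injective _≡_ _≡_ (λ t → w (f t)) → m ≤ n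

AtLeastLetters : {A : Set} → Word A → ℕ → Set
AtLeastLetters w n = Σ (Fin n → ℕ) λ f → Injective _≡_ _≡_ (λ t → w (f t))

ExactlyLetters : {A : Set} → Word A → ℕ → Set
ExactlyLetters w n = AtMostLetters w n × AtLeastLetters w n

SuffixIsPower : {A : Set} → Word A → (N L : ℕ) → (Fin L → A) → Set
SuffixIsPower w N L x = ∀ (q : ℕ) (j : Fin L) → w (N + (q * L + toℕ j)) ≡ x j

{-# OPTIONS --safe #-}
module Submission where

-- Write P for the largest period. Every letter recurs at most P positions later, so the
-- letter at any position i reappears in every window w n ⋯ w (n + P - 1) with n ≥ i: the
-- window slides one step at a time, and when the letter leaves it through its first
-- position it re-enters at most P positions on. Hence a window far enough out sees every
-- letter, giving at most P letters. If there are exactly P, such a window is injective, so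
-- the recurrence at its first position cannot use a shorter period than P; this makes the
-- word P-periodic from there on, and that window is the word x.

open import Defs
open import Data.Nat using (ℕ; suc)
open import Data.Fin using (Fin; fromℕ)
open import Data.Product using (Σ; ∃; _×_)
open import Relation.Binary.PropositionalEquality using (_≡_)
open import Function.Definitions using (Injective)

open import Data.Nat using (zero; _+_; _*_; _≤_; _<_; _≤′_; ≤′-refl; ≤′-step; z≤n; >-nonZero)
open import Data.Nat.Properties
open import Data.Fin using (toℕ; fromℕ<; punchOut)
open import Data.Fin.Properties using (toℕ-injective; toℕ-fromℕ<; ≤fromℕ; injective⇒≤; punchOut-injective; any?)
import Data.Fin.Properties as Fin
open import Data.List using (tabulate)
open import Data.List.Extrema.Nat using (max; xs≤max)
open import Data.List.Relation.Unary.All.Properties using (tabulate⁻)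
open import Data.Product using (_,_; proj₁)
open import Data.Sum using (inj₁; inj₂)
open import Relation.Nullary using (yes; no; contradiction)
open import Relation.Binary.PropositionalEquality using (_≢_; refl; sym; trans; cong; module ≡-Reasoning)

boundedAbove : ∀ {m} (f : Fin m → ℕ) → ∃ λ N → ∀ t → f t ≤ N
boundedAbove f = max 0 (tabulate f) , tabulate⁻ (xs≤max 0 (tabulate f))

injective⇒surjective : ∀ {n} {g : Fin n → Fin n} → Injective _≡_ _≡_ g → ∀ y → ∃ λ x → g x ≡ y
injective⇒surjective {suc n} {g} g-inj y with any? (λ x → g x Fin.≟ y)
... | yes hit = hit
... | no miss = contradiction (injective⇒≤ h-inj) 1+n≰n
  where
  y≢g : ∀ x → y ≢ g x
  y≢g x y≡gx = miss (x , sym y≡gx)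
  h : Fin (suc n) → Fin n
  h x = punchOut (y≢g x)
  h-inj : Injective _≡_ _≡_ h
  h-inj e = g-inj (punchOut-injective (y≢g _) (y≢g _) e)

periodic-shift : ∀ {A : Set} {P} (u : Word A) → (∀ n → u (n + P) ≡ u n) → ∀ q r → u (q * P + r) ≡ u r
periodic-shift u periodic zero r = refl
periodic-shift {P = P} u periodic (suc q) r = begin
  u (P + q * P + r)   ≡⟨ cong u (trans (+-assoc P (q * P) r) (+-comm P (q * P + r))) ⟩
  u (q * P + r + P)   ≡⟨ periodic (q * P + r) ⟩
  u (q * P + r)       ≡⟨ periodic-shift u periodic q r ⟩
  u r                 ∎
  where open ≡-Reasoning

RecursWithin : {A : Set} → Word A → ℕ → Set
RecursWithin w P = ∀ i → ∃ λ d → 0 < d × d ≤ P × w i ≡ w (i + d)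

validPeriods-mono : ∀ {k p} → ValidPeriods k p → ∀ {i j} → toℕ i ≤ toℕ j → p i ≤ p j
validPeriods-mono {p = p} (_ , increasing) {i} {j} i≤j with m≤n⇒m<n∨m≡n i≤j
... | inj₁ i<j = <⇒≤ (increasing i j i<j)
... | inj₂ i≡j = ≤-reflexive (cong p (toℕ-injective i≡j))

pseudoperiod⇒recursWithin : ∀ {A : Set} {w : Word A} {k p} → ValidPeriods k p
  → HasPseudoperiod w k p → RecursWithin w (p (fromℕ k))
pseudoperiod⇒recursWithin valid pseudo i with pseudo i
... | j , wi≡ = _ , <-≤-trans (proj₁ valid) (validPeriods-mono valid z≤n)
                  , validPeriods-mono valid (≤fromℕ j) , wi≡

OccursInWindow : {A : Set} → Word A → ℕ → ℕ → A → Set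
OccursInWindow w P n a = ∃ λ d → d < P × a ≡ w (n + d)

module Recurrence {A : Set} {w : Word A} {P : ℕ} (recurs : RecursWithin w P) where

  0<P : 0 < P
  0<P with recurs 0
  ... | _ , 0<d , d≤P , _ = <-≤-trans 0<d d≤P

  occursInWindow-here : ∀ n → OccursInWindow w P n (w n)
  occursInWindow-here n = 0 , 0<P , cong w (sym (+-identityʳ n))

  occursInWindow-suc : ∀ {n a} → OccursInWindow w P n a → OccursInWindow w P (suc n) a
  occursInWindow-suc {n} (suc d , d+1<P , a≡) = d , <-trans (n<1+n d) d+1<P , trans a≡ (cong w (+-suc n d))
  occursInWindow-suc {n} (zero , _ , a≡) with recurs n
  ... | suc e , _ , e+1≤P , wn≡ =
    e , e+1≤P , trans a≡ (trans (cong w (+-identityʳ n)) (trans wn≡ (cong w (+-suc n e))))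

  occursInWindow-later : ∀ {i n} → i ≤′ n → OccursInWindow w P n (w i)
  occursInWindow-later ≤′-refl = occursInWindow-here _
  occursInWindow-later (≤′-step i≤n) = occursInWindow-suc (occursInWindow-later i≤n)

  window : ℕ → Fin P → A
  window n d = w (n + toℕ d)

  windowIndex : ∀ {n a} → OccursInWindow w P n a → Fin P
  windowIndex (_ , d<P , _) = fromℕ< d<P

  windowIndex-correct : ∀ {n a} (o : OccursInWindow w P n a) → a ≡ window n (windowIndex o)
  windowIndex-correct {n} (d , d<P , a≡) = trans a≡ (cong (λ z → w (n + z)) (sym (toℕ-fromℕ< d<P)))

  sameWindowIndex⇒sameLetter : ∀ {n a b} (o : OccursInWindow w P n a) (o' : OccursInWindow w P n b)
    → windowIndex o ≡ windowIndex o' → a ≡ b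
  sameWindowIndex⇒sameLetter {n} o o' e =
    trans (windowIndex-correct o) (trans (cong (window n) e) (sym (windowIndex-correct o')))

  windowOffset-unique : ∀ {n a} → Injective _≡_ _≡_ (window n)
    → (o o' : OccursInWindow w P n a) → proj₁ o ≡ proj₁ o'
  windowOffset-unique window-inj o@(d , d<P , _) o'@(d' , d'<P , _) = begin
    d                          ≡⟨ toℕ-fromℕ< d<P ⟨
    toℕ (windowIndex o)        ≡⟨ cong toℕ (window-inj (trans (sym (windowIndex-correct o)) (windowIndex-correct o'))) ⟩
    toℕ (windowIndex o')       ≡⟨ toℕ-fromℕ< d'<P ⟩
    d'                         ∎
    where open ≡-Reasoning

  module _ {m} (f : Fin m → ℕ) {N} (f≤N : ∀ t → f t ≤ N) where

    letterOccurs : ∀ t → OccursInWindow w P N (w (f t))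
    letterOccurs t = occursInWindow-later (≤⇒≤′ (f≤N t))

    letterIndex : Fin m → Fin P
    letterIndex t = windowIndex (letterOccurs t)

    letterIndex-injective : Injective _≡_ _≡_ (λ t → w (f t)) → Injective _≡_ _≡_ letterIndex
    letterIndex-injective f-inj e = f-inj (sameWindowIndex⇒sameLetter (letterOccurs _) (letterOccurs _) e)

  atMostLetters : AtMostLetters w P
  atMostLetters m f f-inj with boundedAbove f
  ... | N , f≤N = injective⇒≤ (letterIndex-injective f f≤N f-inj)

  -- The P letters land injectively, hence bijectively, on the P positions of the window.
  window-injective : (f : Fin P → ℕ) → Injective _≡_ _≡_ (λ t → w (f t))
    → ∀ {N} → (∀ t → f t ≤ N) → Injective _≡_ _≡_ (window N)
  window-injective f f-inj f≤N {a} {b} e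
    with injective⇒surjective (letterIndex-injective f f≤N f-inj) a
       | injective⇒surjective (letterIndex-injective f f≤N f-inj) b
  ... | t , refl | t' , refl = cong (letterIndex f f≤N) (f-inj (trans
        (windowIndex-correct (letterOccurs f f≤N t)) (trans e (sym (windowIndex-correct (letterOccurs f f≤N t'))))))

  -- A shorter recurrence would repeat a letter inside the window.
  window-injective⇒period : ∀ {N} → Injective _≡_ _≡_ (window N) → w (N + P) ≡ w N
  window-injective⇒period {N} window-inj with recurs N
  ... | d , 0<d , d≤P , wN≡ with m≤n⇒m<n∨m≡n d≤P
  ...   | inj₂ refl = sym wN≡
  ...   | inj₁ d<P = contradiction
          (windowOffset-unique window-inj (occursInWindow-here N) (d , d<P , wN≡)) (<⇒≢ 0<d)

  injectiveWindows⇒suffixIsPower : ∀ N → (∀ {n} → N ≤ n → Injective _≡_ _≡_ (window n))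
    → SuffixIsPower w N P (window N) × Injective _≡_ _≡_ (window N) × (∀ i → ∃ λ j → window N j ≡ w i)
  injectiveWindows⇒suffixIsPower N window-inj = suffix , window-inj ≤-refl , covers
    where
    shifted-period : ∀ n → w (N + (n + P)) ≡ w (N + n)
    shifted-period n = trans (cong w (sym (+-assoc N n P))) (window-injective⇒period (window-inj (m≤m+n N n)))

    suffix : SuffixIsPower w N P (window N)
    suffix q j = periodic-shift (λ n → w (N + n)) shifted-period q (toℕ j)

    covers : ∀ i → ∃ λ j → window N j ≡ w i
    covers i = windowIndex o , sym (begin
      w i                                    ≡⟨ windowIndex-correct o ⟩
      w (N + i * P + toℕ (windowIndex o))    ≡⟨ cong w (+-assoc N (i * P) _) ⟩
      w (N + (i * P + toℕ (windowIndex o)))  ≡⟨ suffix i (windowIndex o) ⟩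
      window N (windowIndex o)               ∎)
      where
      open ≡-Reasoning
      o : OccursInWindow w P (N + i * P) (w i)
      o = occursInWindow-later (≤⇒≤′ (≤-trans (m≤m*n i P {{>-nonZero 0<P}}) (m≤n+m (i * P) N)))

  atLeastLetters⇒suffixIsPower : AtLeastLetters w P
    → Σ ℕ λ N → Σ (Fin P → A) λ x →
        SuffixIsPower w N P x × Injective _≡_ _≡_ x × (∀ i → ∃ λ j → x j ≡ w i)
  atLeastLetters⇒suffixIsPower (f , f-inj) with boundedAbove f
  ... | N , f≤N = N , window N , injectiveWindows⇒suffixIsPower N
                    (λ N≤n → window-injective f f-inj (λ t → ≤-trans (f≤N t) N≤n))

theorem4 : ∀ (m : ℕ) (w : Word (Fin m)) (k : ℕ) (p : Fin (suc k) → ℕ)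
    → ValidPeriods k p
    → HasPseudoperiod w k p
    → AtMostLetters w (p (fromℕ k))
      × (ExactlyLetters w (p (fromℕ k))
         → Σ ℕ λ N → Σ (Fin (p (fromℕ k)) → Fin m) λ x →
             SuffixIsPower w N (p (fromℕ k)) x
             × Injective _≡_ _≡_ x
             × (∀ (i : ℕ) → ∃ λ (j : Fin (p (fromℕ k))) → x j ≡ w i))
theorem4 m w k p valid pseudo =
  atMostLetters , λ (_ , atLeast) → atLeastLetters⇒suffixIsPower atLeast
  where open Recurrence (pseudoperiod⇒recursWithin valid pseudo)
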